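{- Let $G=(V,E)$ be a graph and $k\ge 0$ an integer such that: (1) no connected component $X$ of $G$ has $G[X]$ trivially perfect; (2) every critical clique of $G$ has at most $k+1$ vertices; (3) for every module $M$ of $G$ with $G[M]$ trivially perfect and every anti-matching $D$ of size $k+1$ in $G[M]$, we have $M=V(D)$; (4) there is no comb $(C,R)$ of $G$ (with ordered partition $(C_1,\dots,C_l)$ of $C$) admitting disjoint sets $\mathcal{C}_a,\mathcal{C}_b$, where $\mathcal{C}_a$ is a $(2k+1)$-packing of $(C_1,\dots,C_l)$ and $\mathcal{C}_b$ is a $(2k+1)$-packing of $(C_l,\dots,C_1)$, with $C\setminus(\mathcal{C}_a\cup\mathcal{C}_b)\ne\emptyset$. Then every module $M$ of $G$ such that $G[M]$ is trivially perfect has at most $11k+2$ vertices.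
   Context: Graphs are finite, simple, undirected; $N_G(X)=\bigcup_{v\in X}N_G(v)\setminus X$. A graph is trivially perfect if it has no induced $C_4$ and no induced $P_4$. A module is a set $M$ with $N(u)\setminus M=N(v)\setminus M$ for all $u,v\in M$; a critical clique is a maximal set of vertices pairwise satisfying $N[u]=N[v]$. An anti-matching is a set of pairwise disjoint pairs of non-adjacent vertices; its size is the number of pairs and $V(D)$ is the set of vertices in its pairs. A comb of $G$ is a pair $(C,R)$ of disjoint vertex subsets such that: $G[C]$ is a clique partitioned into $l$ critical cliques $C_1,\dots,C_l$ of $G$; $R$ is partitioned into $l$ nonempty, pairwise non-adjacent modules $R_1,\dots,R_l$ of $G$ each inducing a trivially perfect graph; $N_G(C_i)\cap R=\bigcup_{j=i}^l R_j$ and $N_G(R_i)\cap C=\bigcup_{j=1}^i C_j$ for $1\le i\le l$; and there exist (possibly empty) sets $V_f,V_p\subseteq V\setminus(C\cup R)$ with $N_G(x)\setminus(C\cup R)=V_p\cup V_f$ for all $x\in C$ and $N_G(y)\setminus(C\cup R)=V_p$ for all $y\in R$. Given an ordered collection $(S_1,\dots,S_q)$ of pairwise disjoint vertex sets and integer $r$, an $r$-packing is a prefix $\{S_1,\dots,S_p\}$ with $\sum_{i\le p}|S_i|\ge r$ and minimum number of vertices for this property, identified with its union. Conditions (1)–(4) express that the instance $(G,k)$ is reduced under the paper's first four reduction rules (none of them applies). -}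

module Defs where

open import Data.Nat using (ℕ; zero; suc; _+_; _*_; _≤_; _<_)
open import Data.Fin using (Fin; toℕ; opposite) renaming (_≤_ to _≤ᶠ_; zero to fzero; suc to fsuc)
open import Data.Fin.Subset using (Subset; _∈_; _∉_; ∣_∣; Nonempty)
open import Data.Bool using (Bool; true; false)
open import Data.Product using (Σ; ∃; ∃-syntax; _×_; _,_)
open import Data.Sum using (_⊎_)
open import Relation.Nullary using (¬_)
open import Relation.Binary.PropositionalEquality using (_≡_; _≢_)
open import Function using (_∘_; _⇔_)

record Graph : Set where
  field
    n      : ℕ
    adj    : Fin n → Fin n → Bool
    sym    : ∀ u v → adj u v ≡ adj v u
    irrefl : ∀ v → adj v v ≡ false

module _ (G : Graph) where
  open Graph G

  V : Set
  V = Fin n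

  VSet : Set
  VSet = Subset n

  E : V → V → Set
  E u v = adj u v ≡ true

  InducedP4 : VSet → Set
  InducedP4 X = Σ V λ a → Σ V λ b → Σ V λ c → Σ V λ d →
    a ∈ X × b ∈ X × c ∈ X × d ∈ X ×
    a ≢ b × a ≢ c × a ≢ d × b ≢ c × b ≢ d × c ≢ d ×
    E a b × E b c × E c d × ¬ E a c × ¬ E b d × ¬ E a d

  InducedC4 : VSet → Set
  InducedC4 X = Σ V λ a → Σ V λ b → Σ V λ c → Σ V λ d →
    a ∈ X × b ∈ X × c ∈ X × d ∈ X ×
    a ≢ b × a ≢ c × a ≢ d × b ≢ c × b ≢ d × c ≢ d ×
    E a b × E b c × E c d × E d a × ¬ E a c × ¬ E b d

  TriviallyPerfect : VSet → Set
  TriviallyPerfect X = ¬ InducedC4 X × ¬ InducedP4 X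

  data WalkIn (X : VSet) : V → V → Set where
    here : ∀ {u} → u ∈ X → WalkIn X u u
    step : ∀ {u w v} → u ∈ X → E u w → WalkIn X w v → WalkIn X u v

  -- X is a connected component of G: nonempty, G[X] connected, and
  -- closed under adjacency (i.e. a maximal connected vertex set)
  ConnectedComponent : VSet → Set
  ConnectedComponent X =
    Nonempty X ×
    (∀ u v → u ∈ X → v ∈ X → WalkIn X u v) ×
    (∀ u v → u ∈ X → E u v → v ∈ X)

  NbhdOf : VSet → V → Set
  NbhdOf X w = w ∉ X × Σ V λ u → u ∈ X × E u w

  SameClosedNbhd : V → V → Set
  SameClosedNbhd u v = ∀ w → ((w ≡ u ⊎ E u w) ⇔ (w ≡ v ⊎ E v w))

  CriticalClique : VSet → Set
  CriticalClique K =
    (∀ u v → u ∈ K → v ∈ K → SameClosedNbhd u v) ×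
    (∀ v → (∀ u → u ∈ K → SameClosedNbhd u v) → v ∈ K)

  Module : VSet → Set
  Module M = ∀ u v → u ∈ M → v ∈ M → ∀ w → w ∉ M → (E u w ⇔ E v w)

  AntiMatchingIn : VSet → (s : ℕ) → (Fin s → V) → (Fin s → V) → Set
  AntiMatchingIn M s a b =
    (∀ i → a i ∈ M × b i ∈ M) ×
    (∀ i → a i ≢ b i × ¬ E (a i) (b i)) ×
    (∀ i j → a i ≡ a j → i ≡ j) ×
    (∀ i j → b i ≡ b j → i ≡ j) ×
    (∀ i j → a i ≢ b j)

  InVD : ∀ {s} → (Fin s → V) → (Fin s → V) → V → Set
  InVD a b v = ∃[ i ] (v ≡ a i ⊎ v ≡ b i)

  prefSum : ∀ {q} → (Fin q → VSet) → ℕ → ℕ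
  prefSum {zero}  S p       = 0
  prefSum {suc q} S zero    = 0
  prefSum {suc q} S (suc p) = ∣ S fzero ∣ + prefSum (S ∘ fsuc) p

  IsPacking : ∀ {q} → (Fin q → VSet) → ℕ → VSet → Set
  IsPacking {q} S r P = Σ ℕ λ p →
    p ≤ q × r ≤ prefSum S p ×
    (∀ p′ → p′ ≤ q → r ≤ prefSum S p′ → prefSum S p ≤ prefSum S p′) ×
    (∀ v → v ∈ P ⇔ (∃[ i ] (toℕ i < p × v ∈ S i)))

  IsComb : VSet → VSet → (l : ℕ) → (Fin l → VSet) → (Fin l → VSet) → Set
  IsComb C R l Cs Rs =
    (∀ v → v ∈ C → v ∉ R) ×
    (∀ u v → u ∈ C → v ∈ C → u ≢ v → E u v) ×
    (∀ v → v ∈ C ⇔ (∃[ i ] v ∈ Cs i)) ×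
    (∀ i j v → v ∈ Cs i → v ∈ Cs j → i ≡ j) ×
    (∀ i → Nonempty (Cs i) × CriticalClique (Cs i)) ×
    (∀ v → v ∈ R ⇔ (∃[ i ] v ∈ Rs i)) ×
    (∀ i j v → v ∈ Rs i → v ∈ Rs j → i ≡ j) ×
    (∀ i → Nonempty (Rs i) × Module (Rs i) × TriviallyPerfect (Rs i)) ×
    (∀ i j u v → i ≢ j → u ∈ Rs i → v ∈ Rs j → ¬ E u v) ×
    (∀ i v → (NbhdOf (Cs i) v × v ∈ R) ⇔ (∃[ j ] (i ≤ᶠ j × v ∈ Rs j))) ×
    (∀ i v → (NbhdOf (Rs i) v × v ∈ C) ⇔ (∃[ j ] (j ≤ᶠ i × v ∈ Cs j))) ×
    (Σ VSet λ Vf → Σ VSet λ Vp →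
      (∀ w → w ∈ Vf → w ∉ C × w ∉ R) ×
      (∀ w → w ∈ Vp → w ∉ C × w ∉ R) ×
      (∀ x → x ∈ C → ∀ w → (E x w × w ∉ C × w ∉ R) ⇔ (w ∈ Vp ⊎ w ∈ Vf)) ×
      (∀ y → y ∈ R → ∀ w → (E y w × w ∉ C × w ∉ R) ⇔ w ∈ Vp))

  Cond1 : Set
  Cond1 = ∀ X → ConnectedComponent X → ¬ TriviallyPerfect X

  Cond2 : ℕ → Set
  Cond2 k = ∀ K → CriticalClique K → ∣ K ∣ ≤ suc k

  Cond3 : ℕ → Set
  Cond3 k = ∀ M → Module M → TriviallyPerfect M →
    ∀ a b → AntiMatchingIn M (suc k) a b →
    ∀ v → (v ∈ M ⇔ InVD a b v)

  Cond4 : ℕ → Set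
  Cond4 k = ∀ C R l Cs Rs → IsComb C R l Cs Rs →
    ¬ (Σ VSet λ Ca → Σ VSet λ Cb →
         IsPacking Cs (suc (2 * k)) Ca ×
         IsPacking (Cs ∘ opposite) (suc (2 * k)) Cb ×
         (∀ v → v ∈ Ca → v ∉ Cb) ×
         (Σ V λ x → x ∈ C × x ∉ Ca × x ∉ Cb))

{-# OPTIONS --safe #-}
-- Grow an anti-matching D in G[M] greedily. If it reaches k + 1 pairs, condition (3) gives M = V(D).
-- Otherwise D is maximal with at most k pairs, so the vertices of M outside V(D) form a clique; let b be
-- one of least degree. In a trivially perfect module the closed neighbourhoods of adjacent vertices are
-- nested, hence every vertex of M outside V(D) lies above b, i.e. N[b] ⊆ N[x]. The vertices of M are
-- then: universal in M or twins of b (two sets of pairwise twins, so at most k + 1 each by (2)); the set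
-- C of the other vertices above b; and at most 2k vertices not above b. Grouping C by degree, and the vertices of
-- M outside N[b] with a neighbour in C by the least degree of such a neighbour, gives a comb. If C had
-- more than 6k + 2 vertices, the (2k + 1)-packings from both ends of the comb would be disjoint and miss
-- a class, contradicting (4).

module Submission where

open import Defs
open import Data.Bool using (true; false)
import Data.Bool as Bool
open import Data.Empty using (⊥; ⊥-elim)
open import Data.Fin using (Fin; toℕ; opposite; fromℕ; fromℕ<) renaming (zero to fzero; suc to fsuc; _≤_ to _≤ᶠ_)
open import Data.Fin.Properties
  using (any?; all?; ¬∀⟶∃¬; toℕ-injective; toℕ<n; toℕ-fromℕ; toℕ-fromℕ<; opposite-prop; opposite-involutive)
  renaming (suc-injective to fsuc-injective; _≟_ to _≟ᶠ_)
open import Data.Fin.Subset using (Subset; _∈_; _∉_; _⊆_; _∪_; ⁅_⁆; ∣_∣; Nonempty; _-_)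
  renaming (⊥ to ∅)
open import Data.Fin.Subset.Properties
  using (_∈?_; p⊆q⇒∣p∣≤∣q∣; p⊂q⇒∣p∣<∣q∣; x∈⁅x⁆; x∈p∪q⁺; ∣⁅x⁆∣≡1; ∣⊥∣≡0; Empty-unique; ∣p∣≤n;
         x∈p∧x≢y⇒x∈p-y; x∈p⇒∣p-x∣<∣p∣; nonempty?)
open import Data.List as List using (List; length)
open import Data.Nat using (ℕ; zero; suc; _+_; _*_; _∸_; _≤_; _<_; z≤n; s≤s; _≤?_; _<?_) renaming (_≟_ to _≟ℕ_)
open import Data.Nat.Properties
open import Data.Nat.Solver using (module +-*-Solver)
open import Data.Product using (Σ; ∃; ∃-syntax; _×_; _,_; proj₁; proj₂; map₂)
open import Data.Sum using (_⊎_; inj₁; inj₂; [_,_]′)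
open import Data.Vec using ([]; _∷_; tabulate)
import Data.Vec.Functional as Vector
open import Data.Vec.Properties using ([]=⇒lookup; lookup⇒[]=; lookup∘tabulate)
open import Function using (_∘_; _$_; id; _⇔_; mk⇔; Equivalence)
open import Relation.Binary using (tri<; tri≈; tri>)
open import Relation.Binary.PropositionalEquality
open import Relation.Nullary using (¬_; Dec; yes; no; contradiction)
open import Relation.Nullary.Decidable using (does; dec-true; decidable-stable; _×-dec_; _⊎-dec_; ¬?; _→-dec_)

private
  variable
    n : ℕ

-- Finite sets

module _ {P : Fin n → Set} (P? : ∀ x → Dec (P x)) where

  abstract
    select : Subset n
    select = tabulate (does ∘ P?)

    ∈-select⁺ : ∀ {x} → P x → x ∈ select
    ∈-select⁺ {x} px = lookup⇒[]= x select (trans (lookup∘tabulate (does ∘ P?) x) (dec-true (P? x) px))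

    ∈-select⁻ : ∀ {x} → x ∈ select → P x
    ∈-select⁻ {x} x∈ with P? x | trans (sym (lookup∘tabulate (does ∘ P?) x)) ([]=⇒lookup x∈)
    ... | yes px | _  = px
    ... | no _   | ()

∣p∪q∣≤∣p∣+∣q∣ : (p q : Subset n) → ∣ p ∪ q ∣ ≤ ∣ p ∣ + ∣ q ∣
∣p∪q∣≤∣p∣+∣q∣ []          []          = z≤n
∣p∪q∣≤∣p∣+∣q∣ (true ∷ p)  (true ∷ q)  = s≤s (≤-trans (m≤n⇒m≤1+n (∣p∪q∣≤∣p∣+∣q∣ p q)) (≤-reflexive (sym (+-suc _ _))))
∣p∪q∣≤∣p∣+∣q∣ (true ∷ p)  (false ∷ q) = s≤s (∣p∪q∣≤∣p∣+∣q∣ p q)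
∣p∪q∣≤∣p∣+∣q∣ (false ∷ p) (true ∷ q)  = ≤-trans (s≤s (∣p∪q∣≤∣p∣+∣q∣ p q)) (≤-reflexive (sym (+-suc _ _)))
∣p∪q∣≤∣p∣+∣q∣ (false ∷ p) (false ∷ q) = ∣p∪q∣≤∣p∣+∣q∣ p q

covered⇒∣p∣≤∣q∣+∣r∣ : {p q r : Subset n} → (∀ {x} → x ∈ p → x ∈ q ⊎ x ∈ r) → ∣ p ∣ ≤ ∣ q ∣ + ∣ r ∣
covered⇒∣p∣≤∣q∣+∣r∣ {q = q} {r} cover = ≤-trans (p⊆q⇒∣p∣≤∣q∣ (x∈p∪q⁺ ∘ cover)) (∣p∪q∣≤∣p∣+∣q∣ q r)

empty⇒∣p∣≡0 : {p : Subset n} → (∀ x → x ∉ p) → ∣ p ∣ ≡ 0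
empty⇒∣p∣≡0 {n} empty = trans (cong ∣_∣ (Empty-unique (λ (x , x∈p) → empty x x∈p))) (∣⊥∣≡0 n)

p⊆q⇒∣q∣≤∣p∣⇒q⊆p : {p q : Subset n} → p ⊆ q → ∣ q ∣ ≤ ∣ p ∣ → q ⊆ p
p⊆q⇒∣q∣≤∣p∣⇒q⊆p {p = p} p⊆q ∣q∣≤∣p∣ {x} x∈q with x ∈? p
... | yes x∈p = x∈p
... | no  x∉p = contradiction ∣q∣≤∣p∣ (<⇒≱ (p⊂q⇒∣p∣<∣q∣ (p⊆q , x , x∈q , x∉p)))

image : ∀ {m} → (Fin m → Fin n) → Subset n
image {m = zero}  f = ∅
image {m = suc m} f = ⁅ f fzero ⁆ ∪ image (f ∘ fsuc)

∈-image : ∀ {m} (f : Fin m → Fin n) i → f i ∈ image f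
∈-image {m = suc m} f fzero    = x∈p∪q⁺ (inj₁ (x∈⁅x⁆ (f fzero)))
∈-image {m = suc m} f (fsuc i) = x∈p∪q⁺ (inj₂ (∈-image (f ∘ fsuc) i))

∣image∣≤ : ∀ {m} (f : Fin m → Fin n) → ∣ image f ∣ ≤ m
∣image∣≤ {n} {zero}  f = ≤-reflexive (∣⊥∣≡0 n)
∣image∣≤ {m = suc m} f = begin
  ∣ ⁅ f fzero ⁆ ∪ image (f ∘ fsuc) ∣    ≤⟨ ∣p∪q∣≤∣p∣+∣q∣ ⁅ f fzero ⁆ (image (f ∘ fsuc)) ⟩
  ∣ ⁅ f fzero ⁆ ∣ + ∣ image (f ∘ fsuc) ∣ ≡⟨ cong (_+ ∣ image (f ∘ fsuc) ∣) (∣⁅x⁆∣≡1 (f fzero)) ⟩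
  suc ∣ image (f ∘ fsuc) ∣              ≤⟨ s≤s (∣image∣≤ (f ∘ fsuc)) ⟩
  suc m                                 ∎
  where open ≤-Reasoning


injection⇒m≤∣p∣ : ∀ {m} {p : Subset n} (f : Fin m → Fin n) →
  (∀ i j → f i ≡ f j → i ≡ j) → (∀ i → f i ∈ p) → m ≤ ∣ p ∣
injection⇒m≤∣p∣ {m = zero}  f inj f∈p = z≤n
injection⇒m≤∣p∣ {m = suc m} {p} f inj f∈p = ≤-trans (s≤s ∣p-f0∣-bound) (x∈p⇒∣p-x∣<∣p∣ (f∈p fzero))
  where
  ∣p-f0∣-bound : m ≤ ∣ p - f fzero ∣
  ∣p-f0∣-bound = injection⇒m≤∣p∣ (f ∘ fsuc) (λ i j → fsuc-injective ∘ inj (fsuc i) (fsuc j))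
    (λ i → x∈p∧x≢y⇒x∈p-y (f∈p (fsuc i)) (λ eq → contradiction (inj (fsuc i) fzero eq) λ ()))

module _ {P : Fin n → Set} (P? : ∀ x → Dec (P x)) where

  abstract
    argmin : (f : Fin n → ℕ) → ∃ P → ∃[ x ] (P x × ∀ y → P y → f x ≤ f y)
    argmin f (x , px) = descend (f x) x px ≤-refl
      where
      descend : ∀ t x → P x → f x ≤ t → ∃[ x ] (P x × ∀ y → P y → f x ≤ f y)
      descend t x px fx≤t with any? (λ y → P? y ×-dec f y <? f x)
      ... | no none = x , px , λ y py → ≮⇒≥ (λ fy<fx → none (y , py , fy<fx))
      descend zero    x px fx≤0   | yes (y , py , fy<fx) = contradiction (≤-trans fy<fx fx≤0) λ ()
      descend (suc t) x px fx≤1+t | yes (y , py , fy<fx) = descend t y py (≤-pred (≤-trans fy<fx fx≤1+t))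

    argmax : (f : Fin n → ℕ) {B : ℕ} → (∀ x → f x ≤ B) → ∃ P → ∃[ x ] (P x × ∀ y → P y → f y ≤ f x)
    argmax f {B} f≤B ∃P with argmin (λ x → B ∸ f x) ∃P
    ... | x , px , minimal = x , px , λ y py → ∸-cancelʳ-≤ (f≤B y) (minimal y py)

-- Closed neighbourhoods

module Neighbourhoods (G : Graph) where

  open Graph G using (adj; irrefl) renaming (n to order)

  Vertex : Set
  Vertex = Fin order

  _~_ : Vertex → Vertex → Set
  _~_ = E G

  _~?_ : ∀ u v → Dec (u ~ v)
  u ~? v = adj u v Bool.≟ true

  ~-sym : ∀ {u v} → u ~ v → v ~ u
  ~-sym {u} {v} u~v = trans (Graph.sym G v u) u~v

  ~⇒≢ : ∀ {u v} → u ~ v → u ≢ v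
  ~⇒≢ {u} u~u refl = contradiction (trans (sym u~u) (irrefl u)) λ ()

  _∈N[_] : Vertex → Vertex → Set
  w ∈N[ u ] = w ≡ u ⊎ u ~ w

  _∈N?[_] : ∀ w u → Dec (w ∈N[ u ])
  w ∈N?[ u ] = (w ≟ᶠ u) ⊎-dec (u ~? w)

  ∈N[]-sym : ∀ {u w} → w ∈N[ u ] → u ∈N[ w ]
  ∈N[]-sym (inj₁ w≡u) = inj₁ (sym w≡u)
  ∈N[]-sym (inj₂ u~w) = inj₂ (~-sym u~w)

  ∈N[]⇒~ : ∀ {u w} → w ∈N[ u ] → w ≢ u → u ~ w
  ∈N[]⇒~ (inj₁ w≡u) w≢u = contradiction w≡u w≢u
  ∈N[]⇒~ (inj₂ u~w) _   = u~w

  infix 4 _≼_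
  _≼_ : Vertex → Vertex → Set
  x ≼ y = ∀ w → w ∈N[ x ] → w ∈N[ y ]

  _≼?_ : ∀ x y → Dec (x ≼ y)
  x ≼? y = all? (λ w → w ∈N?[ x ] →-dec w ∈N?[ y ])

  ≼-refl : ∀ {x} → x ≼ x
  ≼-refl w w∈N[x] = w∈N[x]

  ≼-trans : ∀ {x y z} → x ≼ y → y ≼ z → x ≼ z
  ≼-trans x≼y y≼z w = y≼z w ∘ x≼y w

  ⋠⇒private-neighbour : ∀ {x y} → ¬ x ≼ y → ∃[ w ] (w ∈N[ x ] × ¬ w ∈N[ y ])
  ⋠⇒private-neighbour {x} {y} x⋠y with ¬∀⟶∃¬ order _ (λ w → w ∈N?[ x ] →-dec w ∈N?[ y ]) x⋠y
  ... | w , ¬imp with w ∈N?[ x ]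
  ...   | yes w∈N[x] = w , w∈N[x] , λ w∈N[y] → ¬imp (λ _ → w∈N[y])
  ...   | no  w∉N[x] = contradiction (λ w∈N[x] → contradiction w∈N[x] w∉N[x]) ¬imp

  N[_] : Vertex → Subset order
  N[ x ] = select (_∈N?[ x ])

  deg : Vertex → ℕ
  deg x = ∣ N[ x ] ∣

  deg≤order : ∀ x → deg x ≤ order
  deg≤order x = ∣p∣≤n N[ x ]

  ≼⇒N⊆N : ∀ {x y} → x ≼ y → N[ x ] ⊆ N[ y ]
  ≼⇒N⊆N {x} {y} x≼y = ∈-select⁺ (_∈N?[ y ]) ∘ x≼y _ ∘ ∈-select⁻ (_∈N?[ x ])

  N⊆N⇒≼ : ∀ {x y} → N[ x ] ⊆ N[ y ] → x ≼ y
  N⊆N⇒≼ {x} {y} N⊆N w = ∈-select⁻ (_∈N?[ y ]) ∘ N⊆N ∘ ∈-select⁺ (_∈N?[ x ])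

  ≼⇒deg≤ : ∀ {x y} → x ≼ y → deg x ≤ deg y
  ≼⇒deg≤ = p⊆q⇒∣p∣≤∣q∣ ∘ ≼⇒N⊆N

  ≼⇒deg≤⇒≽ : ∀ {x y} → x ≼ y → deg y ≤ deg x → y ≼ x
  ≼⇒deg≤⇒≽ x≼y deg≤ = N⊆N⇒≼ (p⊆q⇒∣q∣≤∣p∣⇒q⊆p (≼⇒N⊆N x≼y) deg≤)

  ≼∧≽⇒SameClosedNbhd : ∀ {u v} → u ≼ v → v ≼ u → SameClosedNbhd G u v
  ≼∧≽⇒SameClosedNbhd u≼v v≼u w = mk⇔ (u≼v w) (v≼u w)

  SameClosedNbhd⇒≼ : ∀ {u v} → SameClosedNbhd G u v → u ≼ v
  SameClosedNbhd⇒≼ same w = Equivalence.to (same w)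

  SameClosedNbhd⇒≽ : ∀ {u v} → SameClosedNbhd G u v → v ≼ u
  SameClosedNbhd⇒≽ same w = Equivalence.from (same w)

  Twins : Vertex → Subset order
  Twins u = select (λ v → (u ≼? v) ×-dec (v ≼? u))

  Twins-critical : ∀ u → CriticalClique G (Twins u)
  Twins-critical u = pairwise , maximal
    where
    pairwise : ∀ x y → x ∈ Twins u → y ∈ Twins u → SameClosedNbhd G x y
    pairwise x y x∈ y∈ with ∈-select⁻ _ x∈ | ∈-select⁻ _ y∈
    ... | u≼x , x≼u | u≼y , y≼u = ≼∧≽⇒SameClosedNbhd (≼-trans x≼u u≼y) (≼-trans y≼u u≼x)
    maximal : ∀ v → (∀ x → x ∈ Twins u → SameClosedNbhd G x v) → v ∈ Twins u
    maximal v same = ∈-select⁺ _ (SameClosedNbhd⇒≼ same-uv , SameClosedNbhd⇒≽ same-uv)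
      where same-uv = same u (∈-select⁺ _ (≼-refl , ≼-refl))

  pairwise-≼⇒∣p∣≤1+k : ∀ {k} → Cond2 G k → (p : Subset order) →
    (∀ u v → u ∈ p → v ∈ p → u ≼ v) → ∣ p ∣ ≤ suc k
  pairwise-≼⇒∣p∣≤1+k cond2 p ≼-on-p with nonempty? p
  ... | no  empty    = ≤-trans (≤-reflexive (empty⇒∣p∣≡0 (λ x x∈p → empty (x , x∈p)))) z≤n
  ... | yes (u , u∈p) = ≤-trans (p⊆q⇒∣p∣≤∣q∣ p⊆Twins) (cond2 (Twins u) (Twins-critical u))
    where
    p⊆Twins : p ⊆ Twins u
    p⊆Twins {v} v∈p = ∈-select⁺ _ (≼-on-p u v u∈p v∈p , ≼-on-p v u v∈p u∈p)

-- Trivially perfect modules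

module TriviallyPerfectModule (G : Graph) (M : Subset (Graph.n G))
  (M-module : Module G M) (M-tp : TriviallyPerfect G M) where

  open Neighbourhoods G

  no-P4 : ∀ {a b c d} → a ∈ M → b ∈ M → c ∈ M → d ∈ M →
    a ~ b → b ~ c → c ~ d → ¬ a ~ c → ¬ b ~ d → ¬ a ~ d → ⊥
  no-P4 a∈ b∈ c∈ d∈ a~b b~c c~d a≁c b≁d a≁d = proj₂ M-tp
    (_ , _ , _ , _ , a∈ , b∈ , c∈ , d∈ ,
     ~⇒≢ a~b , (λ { refl → a≁d c~d }) , (λ { refl → a≁c (~-sym c~d) }) , ~⇒≢ b~c , (λ { refl → a≁d a~b }) , ~⇒≢ c~d ,
     a~b , b~c , c~d , a≁c , b≁d , a≁d)

  no-C4 : ∀ {a b c d} → a ∈ M → b ∈ M → c ∈ M → d ∈ M → a ≢ c → b ≢ d →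
    a ~ b → b ~ c → c ~ d → d ~ a → ¬ a ~ c → ¬ b ~ d → ⊥
  no-C4 a∈ b∈ c∈ d∈ a≢c b≢d a~b b~c c~d d~a a≁c b≁d = proj₁ M-tp
    (_ , _ , _ , _ , a∈ , b∈ , c∈ , d∈ ,
     ~⇒≢ a~b , a≢c , ~⇒≢ (~-sym d~a) , ~⇒≢ b~c , b≢d , ~⇒≢ c~d ,
     a~b , b~c , c~d , d~a , a≁c , b≁d)

  ~-outside : ∀ {u v w} → u ∈ M → v ∈ M → w ∉ M → u ~ w → v ~ w
  ~-outside {u} {v} {w} u∈M v∈M w∉M = Equivalence.to (M-module u v u∈M v∈M w w∉M)

  ∈⊎∉ : ∀ {v} → Dec (v ∈ M) → v ∈ M ⊎ v ∉ M
  ∈⊎∉ (yes v∈M) = inj₁ v∈M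
  ∈⊎∉ (no  v∉M) = inj₂ v∉M

  ∈M-by-contradiction : ∀ {v} → ¬ v ∉ M → v ∈ M
  ∈M-by-contradiction {v} = decidable-stable (v ∈? M)

  private-neighbour : ∀ {x y} → x ∈ M → y ∈ M → x ~ y → ¬ x ≼ y →
    ∃[ w ] (w ∈ M × x ~ w × ¬ y ~ w × w ≢ y)
  private-neighbour {x} {y} x∈M y∈M x~y x⋠y with ⋠⇒private-neighbour x⋠y
  ... | w , w∈N[x] , w∉N[y] =
    w , ∈M-by-contradiction (λ w∉M → y≁w (~-outside x∈M y∈M w∉M x~w)) , x~w , y≁w , w≢y
    where
    w≢y : w ≢ y
    w≢y = w∉N[y] ∘ inj₁
    y≁w : ¬ y ~ w
    y≁w = w∉N[y] ∘ inj₂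
    x~w : x ~ w
    x~w = ∈N[]⇒~ w∈N[x] (λ { refl → y≁w (~-sym x~y) })

  -- A private neighbour on each side would complete the edge xy to an induced P4 or C4.
  ~⇒≼⊎≽ : ∀ {x y} → x ∈ M → y ∈ M → x ~ y → x ≼ y ⊎ y ≼ x
  ~⇒≼⊎≽ {x} {y} x∈M y∈M x~y with x ≼? y | y ≼? x
  ... | yes x≼y | _       = inj₁ x≼y
  ... | no _    | yes y≼x = inj₂ y≼x
  ... | no x⋠y  | no y⋠x  with private-neighbour x∈M y∈M x~y x⋠y | private-neighbour y∈M x∈M (~-sym x~y) y⋠x
  ...   | w , w∈M , x~w , y≁w , w≢y | z , z∈M , y~z , x≁z , z≢x with w ~? z
  ...     | yes w~z = ⊥-elim $ no-C4 w∈M x∈M y∈M z∈M w≢y (z≢x ∘ sym) (~-sym x~w) x~y y~z (~-sym w~z) (y≁w ∘ ~-sym) x≁z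
  ...     | no  w≁z = ⊥-elim $ no-P4 w∈M x∈M y∈M z∈M (~-sym x~w) x~y y~z (y≁w ∘ ~-sym) x≁z w≁z

  ⊆M⇒TriviallyPerfect : ∀ {X} → X ⊆ M → TriviallyPerfect G X
  ⊆M⇒TriviallyPerfect X⊆M =
    (λ (a , b , c , d , a∈ , b∈ , c∈ , d∈ , rest) → proj₁ M-tp (a , b , c , d , X⊆M a∈ , X⊆M b∈ , X⊆M c∈ , X⊆M d∈ , rest)) ,
    (λ (a , b , c , d , a∈ , b∈ , c∈ , d∈ , rest) → proj₂ M-tp (a , b , c , d , X⊆M a∈ , X⊆M b∈ , X⊆M c∈ , X⊆M d∈ , rest))

module DescendingEnumeration {Q : ℕ → Set} (Q? : ∀ d → Dec (Q d)) (bound : ℕ) where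

  private
    below : ℕ → List ℕ
    below zero    = List.[]
    below (suc m) with Q? m
    ... | yes _ = m List.∷ below m
    ... | no  _ = below m

    below-sound : ∀ m i → Q (List.lookup (below m) i) × List.lookup (below m) i < m
    below-sound (suc m) i with Q? m
    below-sound (suc m) fzero    | yes qm = qm , ≤-refl
    below-sound (suc m) (fsuc i) | yes _  = map₂ m<n⇒m<1+n (below-sound m i)
    below-sound (suc m) i        | no  _  = map₂ m<n⇒m<1+n (below-sound m i)

    below-complete : ∀ m d → Q d → d < m → ∃[ i ] List.lookup (below m) i ≡ d
    below-complete (suc m) d qd d<1+m with Q? m | d ≟ℕ m
    ... | yes _  | yes refl = fzero , refl
    ... | no ¬qm | yes refl = contradiction qd ¬qm
    ... | yes _  | no d≢m   = let (i , eq) = below-complete m d qd (≤∧≢⇒< (≤-pred d<1+m) d≢m) in fsuc i , eq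
    ... | no _   | no d≢m   = below-complete m d qd (≤∧≢⇒< (≤-pred d<1+m) d≢m)

    below-decreasing : ∀ m (i j : Fin (length (below m))) → toℕ i < toℕ j →
      List.lookup (below m) j < List.lookup (below m) i
    below-decreasing (suc m) i j i<j with Q? m
    below-decreasing (suc m) fzero    (fsuc j) i<j       | yes _ = proj₂ (below-sound m j)
    below-decreasing (suc m) (fsuc i) (fsuc j) (s≤s i<j) | yes _ = below-decreasing m i j i<j
    below-decreasing (suc m) i        j        i<j       | no  _ = below-decreasing m i j i<j

  size : ℕ
  size = length (below bound)

  value : Fin size → ℕ
  value = List.lookup (below bound)

  value-sat : ∀ i → Q (value i)
  value-sat = proj₁ ∘ below-sound bound

  value-complete : ∀ {d} → Q d → d < bound → ∃[ i ] value i ≡ d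
  value-complete = below-complete bound _

  <⇒value> : ∀ {i j} → toℕ i < toℕ j → value j < value i
  <⇒value> = below-decreasing bound _ _

  value-injective : ∀ {i j} → value i ≡ value j → i ≡ j
  value-injective {i} {j} eq with <-cmp (toℕ i) (toℕ j)
  ... | tri< i<j _ _ = contradiction (sym eq) (<⇒≢ (<⇒value> i<j))
  ... | tri≈ _ i≡j _ = toℕ-injective i≡j
  ... | tri> _ _ j<i = contradiction eq (<⇒≢ (<⇒value> j<i))

  value≤⇒≥ : ∀ {i j} → value j ≤ value i → toℕ i ≤ toℕ j
  value≤⇒≥ value≤ = ≮⇒≥ (λ j<i → <⇒≱ (<⇒value> j<i) value≤)

  ≤⇒value≥ : ∀ {i j} → toℕ i ≤ toℕ j → value j ≤ value i
  ≤⇒value≥ {i} {j} i≤j with m≤n⇒m<n∨m≡n i≤j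
  ... | inj₁ i<j = <⇒≤ (<⇒value> i<j)
  ... | inj₂ i≡j = ≤-reflexive (cong value (sym (toℕ-injective i≡j)))

-- Packings

opposite+1+toℕ≡n : ∀ {l} (j : Fin l) → toℕ (opposite j) + suc (toℕ j) ≡ l
opposite+1+toℕ≡n j = trans (cong (_+ suc (toℕ j)) (opposite-prop j)) (m∸n+n≡m (toℕ<n j))

≡opposite⇒n≤ : ∀ {l pa pb} {i j : Fin l} → toℕ i ≤ pa → toℕ j < pb → i ≡ opposite j → l ≤ pa + pb
≡opposite⇒n≤ {l} {pa} {pb} {j = j} i≤pa j<pb refl = begin
  l                              ≡⟨ sym (opposite+1+toℕ≡n j) ⟩
  toℕ (opposite j) + suc (toℕ j) ≤⟨ +-mono-≤ i≤pa j<pb ⟩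
  pa + pb                        ∎
  where open ≤-Reasoning

n≤⇒toℕ<⊎opposite< : ∀ {l pa pb} (i : Fin l) → l ≤ pa + pb → toℕ i < pa ⊎ toℕ (opposite i) < pb
n≤⇒toℕ<⊎opposite< {l} {pa} {pb} i l≤pa+pb with toℕ i <? pa
... | yes i<pa = inj₁ i<pa
... | no  i≮pa = inj₂ (+-cancelʳ-≤ (toℕ i) (suc (toℕ (opposite i))) pb (begin
  suc (toℕ (opposite i)) + toℕ i ≡⟨ sym (+-suc (toℕ (opposite i)) (toℕ i)) ⟩
  toℕ (opposite i) + suc (toℕ i) ≡⟨ opposite+1+toℕ≡n i ⟩
  l                              ≤⟨ l≤pa+pb ⟩
  pa + pb                        ≤⟨ +-monoˡ-≤ pb (≮⇒≥ i≮pa) ⟩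
  toℕ i + pb                     ≡⟨ +-comm (toℕ i) pb ⟩
  pb + toℕ i                     ∎))
  where open ≤-Reasoning

twice-3k+1 : ∀ k → (2 * k + suc k) + (2 * k + suc k) ≡ 6 * k + 2
twice-3k+1 = solve 1 (λ k → (con 2 :* k :+ (con 1 :+ k)) :+ (con 2 :* k :+ (con 1 :+ k)) := con 6 :* k :+ con 2) refl
  where open +-*-Solver

module Packings (G : Graph) where

  open Graph G using () renaming (n to order)

  private
    variable
      l : ℕ

  prefSum-zero : (S : Fin l → Subset order) → prefSum G S 0 ≡ 0
  prefSum-zero {zero}  S = refl
  prefSum-zero {suc l} S = refl

  prefSum-mono : (S : Fin l → Subset order) {p p′ : ℕ} → p ≤ p′ → prefSum G S p ≤ prefSum G S p′
  prefSum-mono {zero}  S _ = z≤n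
  prefSum-mono {suc l} S {zero} _ = z≤n
  prefSum-mono {suc l} S {suc p} {suc p′} (s≤s p≤p′) = +-monoʳ-≤ ∣ S fzero ∣ (prefSum-mono (S ∘ fsuc) p≤p′)

  prefSum-suc≤ : (S : Fin l → Subset order) {K : ℕ} → (∀ i → ∣ S i ∣ ≤ K) →
    ∀ p → prefSum G S (suc p) ≤ prefSum G S p + K
  prefSum-suc≤ {zero}  S ∣S∣≤K p = z≤n
  prefSum-suc≤ {suc l} S ∣S∣≤K zero =
    ≤-trans (≤-reflexive (trans (cong (∣ S fzero ∣ +_) (prefSum-zero (S ∘ fsuc))) (+-identityʳ _))) (∣S∣≤K fzero)
  prefSum-suc≤ {suc l} S {K} ∣S∣≤K (suc p) =
    ≤-trans (+-monoʳ-≤ ∣ S fzero ∣ (prefSum-suc≤ (S ∘ fsuc) (∣S∣≤K ∘ fsuc) p))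
            (≤-reflexive (sym (+-assoc ∣ S fzero ∣ (prefSum G (S ∘ fsuc) p) K)))

  prefSum≤p*K : (S : Fin l → Subset order) {K : ℕ} → (∀ i → ∣ S i ∣ ≤ K) → ∀ p → prefSum G S p ≤ p * K
  prefSum≤p*K {zero}  S ∣S∣≤K p       = z≤n
  prefSum≤p*K {suc l} S ∣S∣≤K zero    = z≤n
  prefSum≤p*K {suc l} S ∣S∣≤K (suc p) = +-mono-≤ (∣S∣≤K fzero) (prefSum≤p*K (S ∘ fsuc) (∣S∣≤K ∘ fsuc) p)

  prefixUnion : (S : Fin l → Subset order) → ℕ → Subset order
  prefixUnion S p = select (λ v → any? (λ i → (toℕ i <? p) ×-dec (v ∈? S i)))

  ∈-prefixUnion : (S : Fin l → Subset order) (p : ℕ) →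
    ∀ v → v ∈ prefixUnion S p ⇔ (∃[ i ] (toℕ i < p × v ∈ S i))
  ∈-prefixUnion S p v = mk⇔ (∈-select⁻ _) (∈-select⁺ _)

  ∣T∣≤prefSum : (S : Fin l → Subset order) (p : ℕ) {T : Subset order} →
    (∀ {v} → v ∈ T → ∃[ i ] (toℕ i < p × v ∈ S i)) → ∣ T ∣ ≤ prefSum G S p
  ∣T∣≤prefSum {zero}  S p       T⊆ = ≤-reflexive (empty⇒∣p∣≡0 (λ v v∈T → case-Fin0 (T⊆ v∈T)))
    where
    case-Fin0 : ∀ {A : Fin 0 → Set} → ∃ A → ⊥
    case-Fin0 (() , _)
  ∣T∣≤prefSum {suc l} S zero    T⊆ = ≤-reflexive (empty⇒∣p∣≡0 (λ v v∈T → case-<0 (T⊆ v∈T)))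
    where
    case-<0 : ∀ {A : Fin (suc l) → Set} → ∃[ i ] (toℕ i < 0 × A i) → ⊥
    case-<0 (_ , () , _)
  ∣T∣≤prefSum {suc l} S (suc p) {T} T⊆ =
    ≤-trans (covered⇒∣p∣≤∣q∣+∣r∣ split)
            (+-monoʳ-≤ ∣ S fzero ∣ (∣T∣≤prefSum (S ∘ fsuc) p (Equivalence.to (∈-prefixUnion (S ∘ fsuc) p _))))
    where
    split : ∀ {v} → v ∈ T → v ∈ S fzero ⊎ v ∈ prefixUnion (S ∘ fsuc) p
    split v∈T with T⊆ v∈T
    ... | fzero  , _         , v∈S = inj₁ v∈S
    ... | fsuc i , s≤s i<p   , v∈S = inj₂ (Equivalence.from (∈-prefixUnion (S ∘ fsuc) p _) (i , i<p , v∈S))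

  ∣prefixUnion∣≤prefSum : (S : Fin l → Subset order) (p : ℕ) → ∣ prefixUnion S p ∣ ≤ prefSum G S p
  ∣prefixUnion∣≤prefSum S p = ∣T∣≤prefSum S p (Equivalence.to (∈-prefixUnion S p _))

  abstract
    packing-exists : (S : Fin l → Subset order) {K : ℕ} (r : ℕ) → (∀ i → ∣ S i ∣ ≤ K) →
      suc r ≤ prefSum G S l → ∃[ p ] (IsPacking G S (suc r) (prefixUnion S p) × ∣ prefixUnion S p ∣ ≤ r + K)
    packing-exists {l} S {K} r ∣S∣≤K reaches-l
      with argmin (λ p → suc r ≤? prefSum G S (toℕ p)) toℕ
                  (fromℕ l , subst (λ p → suc r ≤ prefSum G S p) (sym (toℕ-fromℕ l)) reaches-l)
    ... | p , reaches , least =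
      toℕ p , (toℕ p , ≤-pred (toℕ<n p) , reaches , minimal , ∈-prefixUnion S (toℕ p)) ,
      ≤-trans (∣prefixUnion∣≤prefSum S (toℕ p)) (overshoot (toℕ p) below)
      where
      least-ℕ : ∀ q → q ≤ l → suc r ≤ prefSum G S q → toℕ p ≤ q
      least-ℕ q q≤l reaches-q = subst (toℕ p ≤_) (toℕ-fromℕ< (s≤s q≤l))
        (least (fromℕ< (s≤s q≤l)) (subst (λ q → suc r ≤ prefSum G S q) (sym (toℕ-fromℕ< (s≤s q≤l))) reaches-q))
      minimal : ∀ q → q ≤ l → suc r ≤ prefSum G S q → prefSum G S (toℕ p) ≤ prefSum G S q
      minimal q q≤l reaches-q = prefSum-mono S (least-ℕ q q≤l reaches-q)
      below : ∀ q → q < toℕ p → prefSum G S q ≤ r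
      below q q<p = ≮⇒≥ (λ reaches-q → <⇒≱ q<p (least-ℕ q (≤-trans (<⇒≤ q<p) (≤-pred (toℕ<n p))) reaches-q))
      overshoot : ∀ p → (∀ q → q < p → prefSum G S q ≤ r) → prefSum G S p ≤ r + K
      overshoot zero    _     = ≤-trans (≤-reflexive (prefSum-zero S)) z≤n
      overshoot (suc q) below = ≤-trans (prefSum-suc≤ S ∣S∣≤K q) (+-monoˡ-≤ K (below q ≤-refl))

  covering-packing : ∀ k (S : Fin l → Subset order) (C : Subset order) → (∀ i → ∣ S i ∣ ≤ suc k) →
    (∀ {v} → v ∈ C → ∃[ i ] v ∈ S i) → 2 * k < ∣ C ∣ →
    ∃[ p ] (IsPacking G S (suc (2 * k)) (prefixUnion S p) × ∣ prefixUnion S p ∣ ≤ 2 * k + suc k)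
  covering-packing {l} k S C ∣S∣≤1+k C⊆⋃S 2k<∣C∣ = packing-exists S (2 * k) ∣S∣≤1+k
    (≤-trans 2k<∣C∣ (∣T∣≤prefSum S l (λ v∈C → let (i , v∈S) = C⊆⋃S v∈C in i , toℕ<n i , v∈S)))

  -- Each packing has at most 3k + 1 vertices, so together they miss one of the more than 6k + 2 vertices
  -- and cannot reach each other: the first set after the forward packing lies in neither.
  two-sided-packings : ∀ k (S : Fin l → Subset order) (C : Subset order) →
    (∀ i j v → v ∈ S i → v ∈ S j → i ≡ j) → (∀ i → Nonempty (S i)) → (∀ i → ∣ S i ∣ ≤ suc k) →
    (∀ v → v ∈ C ⇔ (∃[ i ] v ∈ S i)) → 6 * k + 2 < ∣ C ∣ →
    Σ (Subset order) λ Ca → Σ (Subset order) λ Cb →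
      IsPacking G S (suc (2 * k)) Ca × IsPacking G (S ∘ opposite) (suc (2 * k)) Cb ×
      (∀ v → v ∈ Ca → v ∉ Cb) × (Σ (Fin order) λ x → x ∈ C × x ∉ Ca × x ∉ Cb)
  two-sided-packings {l} k S C S-disjoint S-nonempty ∣S∣≤1+k C⇔⋃S large =
    prefixUnion S pa , prefixUnion (S ∘ opposite) pb , proj₁ (proj₂ forward) , proj₁ (proj₂ backward) ,
    Ca∩Cb≡∅ , x , Equivalence.from (C⇔⋃S x) (middle , x∈S) , x∉Ca , x∉Cb
    where
    2k<∣C∣ : 2 * k < ∣ C ∣
    2k<∣C∣ = ≤-trans (s≤s (≤-trans (*-monoˡ-≤ k (s≤s (s≤s (z≤n {4})))) (m≤m+n (6 * k) 2))) large
    index : ∀ {v} → v ∈ C → ∃[ i ] v ∈ S i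
    index {v} = Equivalence.to (C⇔⋃S v)
    forward : ∃[ p ] (IsPacking G S (suc (2 * k)) (prefixUnion S p) × ∣ prefixUnion S p ∣ ≤ 2 * k + suc k)
    forward = covering-packing k S C ∣S∣≤1+k index 2k<∣C∣
    backward : ∃[ p ] (IsPacking G (S ∘ opposite) (suc (2 * k)) (prefixUnion (S ∘ opposite) p) ×
                       ∣ prefixUnion (S ∘ opposite) p ∣ ≤ 2 * k + suc k)
    backward = covering-packing k (S ∘ opposite) C (∣S∣≤1+k ∘ opposite)
          (λ {v} v∈C → let (i , v∈S) = index v∈C in opposite i , subst (λ j → v ∈ S j) (sym (opposite-involutive i)) v∈S)
          2k<∣C∣
    pa pb : ℕ
    pa = proj₁ forward
    pb = proj₁ backward
    ∈Ca⁻ : ∀ {v} → v ∈ prefixUnion S pa → ∃[ i ] (toℕ i < pa × v ∈ S i)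
    ∈Ca⁻ = Equivalence.to (∈-prefixUnion S pa _)
    ∈Cb⁻ : ∀ {v} → v ∈ prefixUnion (S ∘ opposite) pb → ∃[ j ] (toℕ j < pb × v ∈ S (opposite j))
    ∈Cb⁻ = Equivalence.to (∈-prefixUnion (S ∘ opposite) pb _)
    ∣Ca∣+∣Cb∣≤6k+2 : ∣ prefixUnion S pa ∣ + ∣ prefixUnion (S ∘ opposite) pb ∣ ≤ 6 * k + 2
    ∣Ca∣+∣Cb∣≤6k+2 = ≤-trans (+-mono-≤ (proj₂ (proj₂ forward)) (proj₂ (proj₂ backward))) (≤-reflexive (twice-3k+1 k))
    pa+pb<l : pa + pb < l
    pa+pb<l = ≰⇒> (λ l≤pa+pb → <⇒≱ large (≤-trans (covered⇒∣p∣≤∣q∣+∣r∣ (cover l≤pa+pb)) ∣Ca∣+∣Cb∣≤6k+2))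
      where
      cover : l ≤ pa + pb → ∀ {v} → v ∈ C → v ∈ prefixUnion S pa ⊎ v ∈ prefixUnion (S ∘ opposite) pb
      cover l≤pa+pb {v} v∈C = let (i , v∈S) = index v∈C in
        [ (λ i<pa → inj₁ (Equivalence.from (∈-prefixUnion S pa v) (i , i<pa , v∈S))) ,
          (λ i′<pb → inj₂ (Equivalence.from (∈-prefixUnion (S ∘ opposite) pb v)
                      (opposite i , i′<pb , subst (λ j → v ∈ S j) (sym (opposite-involutive i)) v∈S))) ]′
        (n≤⇒toℕ<⊎opposite< i l≤pa+pb)
    Ca∩Cb≡∅ : ∀ v → v ∈ prefixUnion S pa → v ∉ prefixUnion (S ∘ opposite) pb
    Ca∩Cb≡∅ v v∈Ca v∈Cb = let (i , i<pa , v∈Si) = ∈Ca⁻ v∈Ca ; (j , j<pb , v∈Sj) = ∈Cb⁻ v∈Cb in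
      <⇒≱ pa+pb<l (≡opposite⇒n≤ (<⇒≤ i<pa) j<pb (S-disjoint _ _ v v∈Si v∈Sj))
    middle : Fin l
    middle = fromℕ< (≤-trans (s≤s (m≤m+n pa pb)) pa+pb<l)
    x : Fin order
    x = proj₁ (S-nonempty middle)
    x∈S : x ∈ S middle
    x∈S = proj₂ (S-nonempty middle)
    toℕ-middle : toℕ middle ≡ pa
    toℕ-middle = toℕ-fromℕ< _
    x∉Ca : x ∉ prefixUnion S pa
    x∉Ca x∈Ca = let (i , i<pa , x∈Si) = ∈Ca⁻ x∈Ca in
      <-irrefl (trans (cong toℕ (S-disjoint i middle x x∈Si x∈S)) toℕ-middle) i<pa
    x∉Cb : x ∉ prefixUnion (S ∘ opposite) pb
    x∉Cb x∈Cb = let (j , j<pb , x∈Sj) = ∈Cb⁻ x∈Cb in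
      <⇒≱ pa+pb<l (≡opposite⇒n≤ (≤-reflexive toℕ-middle) j<pb (S-disjoint middle _ x x∈S x∈Sj))

-- The comb bound 6k + 2 on the middle part only pays off for k ≥ 2; for k ≤ 1 the middle part
-- has at most 2k classes of size at most k + 1.
parts≤11k+2 : ∀ k {c} → c ≤ 6 * k + 2 → c ≤ (k + k) * suc k → (suc k + suc k) + (c + (k + k)) ≤ 11 * k + 2
parts≤11k+2 zero          _    c≤0 = s≤s (s≤s (≤-trans (≤-reflexive (+-identityʳ _)) c≤0))
parts≤11k+2 (suc zero)    _    c≤4 = s≤s (s≤s (s≤s (s≤s (≤-trans (+-monoˡ-≤ 2 c≤4) (m≤m+n 6 3)))))
parts≤11k+2 (suc (suc j)) c≤6k+2 _ = ≤-trans (+-monoʳ-≤ (3 + j + (3 + j)) (+-monoˡ-≤ (2 + j + (2 + j)) c≤6k+2))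
                                             (≤-trans (m≤m+n _ j) (≤-reflexive (eq j)))
  where
  open +-*-Solver
  eq : ∀ j → (3 + j + (3 + j)) + ((6 * (2 + j) + 2) + (2 + j + (2 + j))) + j ≡ 11 * (2 + j) + 2
  eq = solve 1 (λ j → ((con 3 :+ j) :+ (con 3 :+ j)) :+ ((con 6 :* (con 2 :+ j) :+ con 2) :+ ((con 2 :+ j) :+ (con 2 :+ j))) :+ j
                      := con 11 :* (con 2 :+ j) :+ con 2) refl

-- Combs

module CombBelow (G : Graph) (M : Subset (Graph.n G))
  (M-module : Module G M) (M-tp : TriviallyPerfect G M) (b : Fin (Graph.n G)) (b∈M : b ∈ M) where

  open Graph G using () renaming (n to order)
  open Neighbourhoods G
  open TriviallyPerfectModule G M M-module M-tp

  Above : Vertex → Set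
  Above x = x ∈ M × x ∈N[ b ] × b ≼ x

  Above? : ∀ x → Dec (Above x)
  Above? x = (x ∈? M) ×-dec (x ∈N?[ b ] ×-dec b ≼? x)

  Universal : Vertex → Set
  Universal x = ∀ m → m ∈ M → m ∈N[ x ]

  Universal? : ∀ x → Dec (Universal x)
  Universal? x = all? (λ m → (m ∈? M) →-dec m ∈N?[ x ])

  InC : Vertex → Set
  InC x = Above x × ¬ Universal x × ¬ x ≼ b

  InC? : ∀ x → Dec (InC x)
  InC? x = Above? x ×-dec (¬? (Universal? x) ×-dec ¬? (x ≼? b))

  InR : Vertex → Set
  InR y = y ∈ M × ¬ Above y × ¬ y ∈N[ b ] × ∃[ x ] (InC x × y ~ x)

  InR? : ∀ y → Dec (InR y)
  InR? y = (y ∈? M) ×-dec (¬? (Above? y) ×-dec (¬? (y ∈N?[ b ]) ×-dec any? (λ x → InC? x ×-dec (y ~? x))))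

  Above-b : Above b
  Above-b = b∈M , inj₁ refl , ≼-refl

  Above⇒∈N[] : ∀ {x x′} → Above x → Above x′ → x′ ∈N[ x ]
  Above⇒∈N[] (_ , _ , b≼x) (_ , x′∈N[b] , _) = b≼x _ x′∈N[b]

  Above⇒deg≤⇒≼ : ∀ {x x′} → Above x → Above x′ → deg x′ ≤ deg x → x′ ≼ x
  Above⇒deg≤⇒≼ {x} {x′} above above′ deg≤ with Above⇒∈N[] above above′
  ... | inj₁ refl = ≼-refl
  ... | inj₂ x~x′ with ~⇒≼⊎≽ (proj₁ above) (proj₁ above′) x~x′
  ...   | inj₁ x≼x′ = ≼⇒deg≤⇒≽ x≼x′ deg≤
  ...   | inj₂ x′≼x = x′≼x

  InC⇒∈M : ∀ {x} → InC x → x ∈ M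
  InC⇒∈M ((x∈M , _) , _) = x∈M

  InC⇒b~ : ∀ {x} → InC x → b ~ x
  InC⇒b~ ((_ , x∈N[b] , _) , _ , x⋠b) = ∈N[]⇒~ x∈N[b] (λ { refl → x⋠b ≼-refl })

  InC⇒deg-b< : ∀ {x} → InC x → deg b < deg x
  InC⇒deg-b< ((_ , _ , b≼x) , _ , x⋠b) = ≰⇒> (x⋠b ∘ ≼⇒deg≤⇒≽ b≼x)

  InC⇒≢InR : ∀ {x y} → InC x → InR y → x ≢ y
  InC⇒≢InR (above , _) (_ , ¬above , _) refl = ¬above above

  InR⇒¬∈N[b] : ∀ {y} → InR y → ¬ y ∈N[ b ]
  InR⇒¬∈N[b] (_ , _ , y∉N[b] , _) = y∉N[b]

  ~InR⇒⋠b : ∀ {y w} → InR y → y ~ w → ¬ w ≼ b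
  ~InR⇒⋠b R-y y~w w≼b = InR⇒¬∈N[b] R-y (w≼b _ (inj₂ (~-sym y~w)))

  -- Otherwise b - x - y - w would be an induced P4.
  ~-extends-from-C : ∀ {x y w} → InC x → x ~ y → y ~ w → ¬ y ∈N[ b ] → ¬ w ∈N[ b ] → x ≢ w →
    y ∈ M → w ∈ M → x ~ w
  ~-extends-from-C {x} {y} {w} C-x x~y y~w y∉N[b] w∉N[b] x≢w y∈M w∈M with x ~? w
  ... | yes x~w = x~w
  ... | no  x≁w = ⊥-elim (no-P4 b∈M (InC⇒∈M C-x) y∈M w∈M (InC⇒b~ C-x) x~y y~w (y∉N[b] ∘ inj₂) x≁w (w∉N[b] ∘ inj₂))

  ~InC⇒InR : ∀ {x w} → InC x → x ~ w → w ∈ M → ¬ Above w → ¬ w ∈N[ b ] → InR w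
  ~InC⇒InR C-x x~w w∈M ¬above w∉N[b] = w∈M , ¬above , w∉N[b] , _ , C-x , ~-sym x~w

  Above∖C⇒Universal⊎≼b : ∀ {w} → Above w → ¬ InC w → Universal w ⊎ w ≼ b
  Above∖C⇒Universal⊎≼b {w} above ¬C with Universal? w | w ≼? b
  ... | yes universal | _ = inj₁ universal
  ... | no _          | yes w≼b = inj₂ w≼b
  ... | no ¬universal | no w⋠b = contradiction (above , ¬universal , w⋠b) ¬C

  ∈N[b]∖Above⇒≼b : ∀ {w} → w ∈ M → w ∈N[ b ] → ¬ Above w → w ≼ b
  ∈N[b]∖Above⇒≼b w∈M (inj₁ refl) ¬above = contradiction Above-b ¬above
  ∈N[b]∖Above⇒≼b w∈M (inj₂ b~w) ¬above with ~⇒≼⊎≽ b∈M w∈M b~w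
  ... | inj₁ b≼w = contradiction (w∈M , inj₂ b~w , b≼w) ¬above
  ... | inj₂ w≼b = w≼b

  ~InR⇒Universal : ∀ {y w} → InR y → y ~ w → ¬ InC w → ¬ InR w → Universal w
  ~InR⇒Universal {y} {w} R-y@(y∈M , _ , y∉N[b] , x , C-x , y~x) y~w ¬C ¬R with w ∈? M
  ... | no w∉M = λ m m∈M → inj₂ (~-sym (~-outside y∈M m∈M w∉M y~w))
  ... | yes w∈M with Above? w
  ...   | yes above = [ id , (λ w≼b → contradiction w≼b (~InR⇒⋠b R-y y~w)) ]′ (Above∖C⇒Universal⊎≼b above ¬C)
  ...   | no ¬above with w ∈N?[ b ]
  ...     | yes w∈N[b] = contradiction (∈N[b]∖Above⇒≼b w∈M w∈N[b] ¬above) (~InR⇒⋠b R-y y~w)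
  ...     | no  w∉N[b] = contradiction
    (~InC⇒InR C-x (~-extends-from-C C-x (~-sym y~x) y~w y∉N[b] w∉N[b] (λ { refl → ¬C C-x }) y∈M w∈M) w∈M ¬above w∉N[b]) ¬R

  Universal⇒~InR : ∀ {y w} → InR y → ¬ InR w → Universal w → y ~ w
  Universal⇒~InR R-y ¬R universal = ~-sym (∈N[]⇒~ (universal _ (proj₁ R-y)) (λ { refl → ¬R R-y }))

  InR-edge⇒same-C-neighbours : ∀ {y w x} → InR y → InR w → y ~ w → InC x → y ~ x → w ~ x
  InR-edge⇒same-C-neighbours R-y R-w y~w C-x y~x = ~-sym (~-extends-from-C C-x (~-sym y~x) y~w
    (InR⇒¬∈N[b] R-y) (InR⇒¬∈N[b] R-w) (InC⇒≢InR C-x R-w) (proj₁ R-y) (proj₁ R-w))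

  -- The i-th class of C consists of its vertices of the i-th largest degree; a vertex of R belongs to the
  -- class of its neighbours in C of least degree.
  open DescendingEnumeration (λ d → any? (λ x → InC? x ×-dec (deg x ≟ℕ d))) (suc order)
    renaming (size to l; value to degreeOf)

  InC⇒index : ∀ {x} → InC x → ∃[ i ] degreeOf i ≡ deg x
  InC⇒index {x} C-x = value-complete (x , C-x , refl) (s≤s (deg≤order x))

  InCOfDegree? : ∀ i x → Dec (InC x × deg x ≡ degreeOf i)
  InCOfDegree? i x = InC? x ×-dec (deg x ≟ℕ degreeOf i)

  LeastCNeighbour : Fin l → Vertex → Set
  LeastCNeighbour i y = (∃[ x ] (InC x × y ~ x × deg x ≡ degreeOf i)) × (∀ x → InC x → y ~ x → degreeOf i ≤ deg x)

  LeastCNeighbour? : ∀ i y → Dec (LeastCNeighbour i y)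
  LeastCNeighbour? i y = any? (λ x → InC? x ×-dec (y ~? x ×-dec (deg x ≟ℕ degreeOf i)))
                  ×-dec all? (λ x → InC? x →-dec (y ~? x →-dec (degreeOf i ≤? deg x)))

  InROfClass? : ∀ i y → Dec (InR y × LeastCNeighbour i y)
  InROfClass? i y = InR? y ×-dec LeastCNeighbour? i y

  C R : Subset order
  C = select InC?
  R = select InR?

  Cs Rs : Fin l → Subset order
  Cs i = select (InCOfDegree? i)
  Rs i = select (InROfClass? i)

  LeastCNeighbour-unique : ∀ {i j y w} → LeastCNeighbour i y → LeastCNeighbour j w →
    (∀ {x} → InC x → y ~ x → w ~ x) → (∀ {x} → InC x → w ~ x → y ~ x) → i ≡ j
  LeastCNeighbour-unique ((x , C-x , y~x , deg-x) , least-y) ((x′ , C-x′ , w~x′ , deg-x′) , least-w) y⇒w w⇒y =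
    value-injective (≤-antisym (≤-trans (least-y x′ C-x′ (w⇒y C-x′ w~x′)) (≤-reflexive deg-x′))
                               (≤-trans (least-w x C-x (y⇒w C-x y~x)) (≤-reflexive deg-x)))

  InR⇒class : ∀ {y} → InR y → ∃[ i ] (InR y × LeastCNeighbour i y)
  InR⇒class {y} R-y =
    let (x , (C-x , y~x) , least) = argmin (λ x → InC? x ×-dec (y ~? x)) deg (proj₂ (proj₂ (proj₂ R-y)))
        (i , deg-i) = InC⇒index C-x
    in i , R-y , (x , C-x , y~x , sym deg-i) , λ z C-z y~z → ≤-trans (≤-reflexive deg-i) (least z (C-z , y~z))

  class⇒~InC⇒≤ : ∀ {i y w} → InR y × LeastCNeighbour i y → InC w → y ~ w → degreeOf i ≤ deg w
  class⇒~InC⇒≤ (_ , _ , least) C-w y~w = least _ C-w y~w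

  class⇒≤⇒~InC : ∀ {i y w} → InR y × LeastCNeighbour i y → InC w → degreeOf i ≤ deg w → y ~ w
  class⇒≤⇒~InC (R-y , (x , C-x , y~x , deg-x) , _) C-w deg≤ =
    ~-sym (∈N[]⇒~ (Above⇒deg≤⇒≼ (proj₁ C-w) (proj₁ C-x) (≤-trans (≤-reflexive deg-x) deg≤) _ (inj₂ (~-sym y~x)))
                   (InC⇒≢InR C-w R-y ∘ sym))

  InR-edge⇒same-class : ∀ {i j y w} → InR y × LeastCNeighbour i y → InR w × LeastCNeighbour j w → y ~ w → i ≡ j
  InR-edge⇒same-class (R-y , least-y) (R-w , least-w) y~w = LeastCNeighbour-unique least-y least-w
    (InR-edge⇒same-C-neighbours R-y R-w y~w) (InR-edge⇒same-C-neighbours R-w R-y (~-sym y~w))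

  private-neighbour⇒class : ∀ {i x x′ y} → InC x → deg x ≡ degreeOf i → Above x′ →
    (∀ z → Above z × deg z < deg x → deg z ≤ deg x′) → y ∈N[ x ] → ¬ y ∈N[ x′ ] → InR y × LeastCNeighbour i y
  private-neighbour⇒class {i} {x} {x′} {y} C-x deg-x above′ highest y∈N[x] y∉N[x′] =
    (y∈M , ¬above , y∉N[x′] ∘ proj₂ (proj₂ above′) y , x , C-x , ~-sym x~y) , (x , C-x , ~-sym x~y , deg-x) , least
    where
    x~y : x ~ y
    x~y = ∈N[]⇒~ y∈N[x] (λ { refl → y∉N[x′] (Above⇒∈N[] above′ (proj₁ C-x)) })
    y∈M : y ∈ M
    y∈M = ∈M-by-contradiction (λ y∉M → y∉N[x′] (inj₂ (~-outside (InC⇒∈M C-x) (proj₁ above′) y∉M x~y)))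
    ¬above : ¬ Above y
    ¬above = y∉N[x′] ∘ Above⇒∈N[] above′
    least : ∀ z → InC z → y ~ z → degreeOf i ≤ deg z
    least z C-z y~z = ≮⇒≥ λ deg-z< → y∉N[x′] (Above⇒deg≤⇒≼ above′ (proj₁ C-z)
      (highest z (proj₁ C-z , subst (deg z <_) (sym deg-x) deg-z<)) y (inj₂ (~-sym y~z)))

  -- y is a private neighbour of a vertex x of class i over the highest vertex x′ above b of smaller degree.
  class-inhabited : ∀ i → ∃[ y ] (InR y × LeastCNeighbour i y)
  class-inhabited i =
    let (x , C-x , deg-x) = value-sat i
        (x′ , (above′ , deg-x′<) , highest) =
          argmax (λ z → Above? z ×-dec (deg z <? deg x)) deg deg≤order (b , Above-b , InC⇒deg-b< C-x)
        (y , y∈N[x] , y∉N[x′]) = ⋠⇒private-neighbour (<⇒≱ deg-x′< ∘ ≼⇒deg≤)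
    in y , private-neighbour⇒class C-x deg-x above′ highest y∈N[x] y∉N[x′]

  ≼-Universal : ∀ {x y} → x ≼ y → Universal x → Universal y
  ≼-Universal x≼y universal m m∈M = x≼y m (universal m m∈M)

  SameClosedNbhd-InC : ∀ {u v} → InC u → SameClosedNbhd G u v → InC v × deg v ≡ deg u
  SameClosedNbhd-InC {u} {v} ((u∈M , _ , b≼u) , ¬universal-u , u⋠b) same =
    ((v∈M , ∈N[]-sym (b≼v _ (inj₁ refl)) , b≼v) , ¬universal-u ∘ ≼-Universal v≼u , u⋠b ∘ ≼-trans u≼v) ,
    ≤-antisym (≼⇒deg≤ v≼u) (≼⇒deg≤ u≼v)
    where
    u≼v : u ≼ v
    u≼v = SameClosedNbhd⇒≼ same
    v≼u : v ≼ u
    v≼u = SameClosedNbhd⇒≽ same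
    b≼v : b ≼ v
    b≼v = ≼-trans b≼u u≼v
    v∈M : v ∈ M
    v∈M = ∈M-by-contradiction λ v∉M → ¬universal-u λ m m∈M →
      v≼u m (inj₂ (~-sym (~-outside u∈M m∈M v∉M (∈N[]⇒~ (v≼u v (inj₁ refl)) (λ { refl → v∉M u∈M })))))

  Cs-critical : ∀ i → CriticalClique G (Cs i)
  Cs-critical i = pairwise , maximal
    where
    pairwise : ∀ u v → u ∈ Cs i → v ∈ Cs i → SameClosedNbhd G u v
    pairwise u v u∈ v∈ =
      let (C-u , deg-u) = ∈-select⁻ _ u∈ ; (C-v , deg-v) = ∈-select⁻ _ v∈ in
      ≼∧≽⇒SameClosedNbhd (Above⇒deg≤⇒≼ (proj₁ C-v) (proj₁ C-u) (≤-reflexive (trans deg-u (sym deg-v))))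
                         (Above⇒deg≤⇒≼ (proj₁ C-u) (proj₁ C-v) (≤-reflexive (trans deg-v (sym deg-u))))
    maximal : ∀ v → (∀ u → u ∈ Cs i → SameClosedNbhd G u v) → v ∈ Cs i
    maximal v same =
      let (u , C-u , deg-u) = value-sat i
          (C-v , deg-v) = SameClosedNbhd-InC C-u (same u (∈-select⁺ _ (C-u , deg-u)))
      in ∈-select⁺ _ (C-v , trans deg-v deg-u)

  Cs-nonempty : ∀ i → Nonempty (Cs i)
  Cs-nonempty i = let (x , C-x , deg-x) = value-sat i in x , ∈-select⁺ _ (C-x , deg-x)

  Rs-nonempty : ∀ i → Nonempty (Rs i)
  Rs-nonempty i = let (y , class-y) = class-inhabited i in y , ∈-select⁺ _ class-y

  InC⇒∈Cs : ∀ {x} → InC x → ∃[ i ] x ∈ Cs i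
  InC⇒∈Cs C-x = let (i , deg-i) = InC⇒index C-x in i , ∈-select⁺ _ (C-x , sym deg-i)

  C⇔⋃Cs : ∀ v → v ∈ C ⇔ (∃[ i ] v ∈ Cs i)
  C⇔⋃Cs v = mk⇔ (InC⇒∈Cs ∘ ∈-select⁻ _) (λ (_ , v∈Cs) → ∈-select⁺ _ (proj₁ (∈-select⁻ _ v∈Cs)))

  R⇔⋃Rs : ∀ v → v ∈ R ⇔ (∃[ i ] v ∈ Rs i)
  R⇔⋃Rs v = mk⇔ (λ v∈R → map₂ (∈-select⁺ _) (InR⇒class (∈-select⁻ _ v∈R)))
                (λ (_ , v∈Rs) → ∈-select⁺ _ (proj₁ (∈-select⁻ _ v∈Rs)))

  Cs-disjoint : ∀ i j v → v ∈ Cs i → v ∈ Cs j → i ≡ j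
  Cs-disjoint i j v v∈Csi v∈Csj = value-injective (trans (sym (proj₂ (∈-select⁻ _ v∈Csi))) (proj₂ (∈-select⁻ _ v∈Csj)))

  Rs-disjoint : ∀ i j v → v ∈ Rs i → v ∈ Rs j → i ≡ j
  Rs-disjoint i j v v∈Rsi v∈Rsj =
    LeastCNeighbour-unique (proj₂ (∈-select⁻ _ v∈Rsi)) (proj₂ (∈-select⁻ _ v∈Rsj)) (λ _ → id) (λ _ → id)

  Rs-~-transfer : ∀ {i u v w} → u ∈ Rs i → v ∈ Rs i → w ∉ Rs i → u ~ w → v ~ w
  Rs-~-transfer {i} {u} {v} {w} u∈ v∈ w∉ u~w = by-cases (InC? w) (InR? w)
    where
    class-u : InR u × LeastCNeighbour i u
    class-u = ∈-select⁻ _ u∈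
    class-v : InR v × LeastCNeighbour i v
    class-v = ∈-select⁻ _ v∈
    by-cases : Dec (InC w) → Dec (InR w) → v ~ w
    by-cases (yes C-w) _       = class⇒≤⇒~InC class-v C-w (class⇒~InC⇒≤ class-u C-w u~w)
    by-cases (no ¬C)   (yes R-w) = let (j , class-w) = InR⇒class R-w in contradiction
      (subst (λ k → w ∈ Rs k) (sym (InR-edge⇒same-class class-u class-w u~w)) (∈-select⁺ _ class-w)) w∉
    by-cases (no ¬C)   (no ¬R) = Universal⇒~InR (proj₁ class-v) ¬R (~InR⇒Universal (proj₁ class-u) u~w ¬C ¬R)

  Rs-module : ∀ i → Module G (Rs i)
  Rs-module i u v u∈ v∈ w w∉ = mk⇔ (Rs-~-transfer u∈ v∈ w∉) (Rs-~-transfer v∈ u∈ w∉)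

  Rs-non-adjacent : ∀ i j u v → i ≢ j → u ∈ Rs i → v ∈ Rs j → ¬ u ~ v
  Rs-non-adjacent i j u v i≢j u∈ v∈ u~v = i≢j (InR-edge⇒same-class (∈-select⁻ _ u∈) (∈-select⁻ _ v∈) u~v)

  N[Cs]∩R⁻ : ∀ {i v} → NbhdOf G (Cs i) v × v ∈ R → ∃[ j ] (i ≤ᶠ j × v ∈ Rs j)
  N[Cs]∩R⁻ ((_ , u , u∈Cs , u~v) , v∈R) =
    let (j , class-v) = InR⇒class (∈-select⁻ _ v∈R) ; (C-u , deg-u) = ∈-select⁻ _ u∈Cs in
    j , value≤⇒≥ (≤-trans (class⇒~InC⇒≤ class-v C-u (~-sym u~v)) (≤-reflexive deg-u)) , ∈-select⁺ _ class-v

  N[Cs]∩R⁺ : ∀ {i v} → ∃[ j ] (i ≤ᶠ j × v ∈ Rs j) → NbhdOf G (Cs i) v × v ∈ R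
  N[Cs]∩R⁺ {i} (j , i≤j , v∈Rs) =
    let class-v = ∈-select⁻ _ v∈Rs ; (u , C-u , deg-u) = value-sat i in
    ((λ v∈Cs → InC⇒≢InR (proj₁ (∈-select⁻ _ v∈Cs)) (proj₁ class-v) refl) , u , ∈-select⁺ _ (C-u , deg-u) ,
     ~-sym (class⇒≤⇒~InC class-v C-u (≤-trans (≤⇒value≥ i≤j) (≤-reflexive (sym deg-u))))) ,
    ∈-select⁺ _ (proj₁ class-v)

  N[Rs]∩C⁻ : ∀ {i v} → NbhdOf G (Rs i) v × v ∈ C → ∃[ j ] (j ≤ᶠ i × v ∈ Cs j)
  N[Rs]∩C⁻ ((_ , u , u∈Rs , u~v) , v∈C) =
    let C-v = ∈-select⁻ _ v∈C ; (j , deg-j) = InC⇒index C-v in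
    j , value≤⇒≥ (≤-trans (class⇒~InC⇒≤ (∈-select⁻ _ u∈Rs) C-v u~v) (≤-reflexive (sym deg-j))) ,
    ∈-select⁺ _ (C-v , sym deg-j)

  N[Rs]∩C⁺ : ∀ {i v} → ∃[ j ] (j ≤ᶠ i × v ∈ Cs j) → NbhdOf G (Rs i) v × v ∈ C
  N[Rs]∩C⁺ {i} (j , j≤i , v∈Cs) =
    let (C-v , deg-v) = ∈-select⁻ _ v∈Cs ; (u , class-u) = class-inhabited i in
    ((λ v∈Rs → InC⇒≢InR C-v (proj₁ (∈-select⁻ _ v∈Rs)) refl) , u , ∈-select⁺ _ class-u ,
     class⇒≤⇒~InC class-u C-v (≤-trans (≤⇒value≥ j≤i) (≤-reflexive (sym deg-v)))) ,
    ∈-select⁺ _ C-v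

  InC-outer-neighbour : ∀ {x w} → InC x → x ~ w → ¬ InC w → ¬ InR w → Universal w ⊎ w ∈N[ b ]
  InC-outer-neighbour {x} {w} C-x x~w ¬C ¬R with w ∈? M
  ... | no w∉M = inj₁ λ m m∈M → inj₂ (~-sym (~-outside (InC⇒∈M C-x) m∈M w∉M x~w))
  ... | yes w∈M with Above? w
  ...   | yes above = [ inj₁ , (λ _ → inj₂ (proj₁ (proj₂ above))) ]′ (Above∖C⇒Universal⊎≼b above ¬C)
  ...   | no ¬above with w ∈N?[ b ]
  ...     | yes w∈N[b] = inj₂ w∈N[b]
  ...     | no  w∉N[b] = contradiction (~InC⇒InR C-x x~w w∈M ¬above w∉N[b]) ¬R

  InC-~-outer : ∀ {x w} → InC x → ¬ InC w → Universal w ⊎ w ∈N[ b ] → x ~ w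
  InC-~-outer C-x ¬C (inj₁ universal) = ~-sym (∈N[]⇒~ (universal _ (InC⇒∈M C-x)) (λ { refl → ¬C C-x }))
  InC-~-outer C-x@((_ , _ , b≼x) , _) ¬C (inj₂ w∈N[b]) = ∈N[]⇒~ (b≼x _ w∈N[b]) (λ { refl → ¬C C-x })

  Vp Vf : Subset order
  Vp = select (λ w → ¬? (InC? w) ×-dec (¬? (InR? w) ×-dec Universal? w))
  Vf = select (λ w → ¬? (InC? w) ×-dec (¬? (InR? w) ×-dec w ∈N?[ b ]))

  outside : ∀ {w} → ¬ InC w × ¬ InR w → w ∉ C × w ∉ R
  outside (¬C , ¬R) = ¬C ∘ ∈-select⁻ _ , ¬R ∘ ∈-select⁻ _

  Vp-outer : ∀ {w} → w ∈ Vp → ¬ InC w × ¬ InR w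
  Vp-outer w∈Vp = let (¬C , ¬R , _) = ∈-select⁻ _ w∈Vp in ¬C , ¬R

  Vf-outer : ∀ {w} → w ∈ Vf → ¬ InC w × ¬ InR w
  Vf-outer w∈Vf = let (¬C , ¬R , _) = ∈-select⁻ _ w∈Vf in ¬C , ¬R

  C-outer⁻ : ∀ {x w} → x ∈ C → x ~ w × w ∉ C × w ∉ R → w ∈ Vp ⊎ w ∈ Vf
  C-outer⁻ {w = w} x∈C (x~w , w∉C , w∉R) =
    [ (λ universal → inj₁ (∈-select⁺ _ (¬C , ¬R , universal))) , (λ w∈N[b] → inj₂ (∈-select⁺ _ (¬C , ¬R , w∈N[b]))) ]′
      (InC-outer-neighbour (∈-select⁻ _ x∈C) x~w ¬C ¬R)
    where
    ¬C : ¬ InC w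
    ¬C = w∉C ∘ ∈-select⁺ _
    ¬R : ¬ InR w
    ¬R = w∉R ∘ ∈-select⁺ _

  C-outer⁺ : ∀ {x w} → x ∈ C → w ∈ Vp ⊎ w ∈ Vf → x ~ w × w ∉ C × w ∉ R
  C-outer⁺ x∈C (inj₁ w∈Vp) = let (¬C , ¬R , universal) = ∈-select⁻ _ w∈Vp in
    InC-~-outer (∈-select⁻ _ x∈C) ¬C (inj₁ universal) , outside (¬C , ¬R)
  C-outer⁺ x∈C (inj₂ w∈Vf) = let (¬C , ¬R , w∈N[b]) = ∈-select⁻ _ w∈Vf in
    InC-~-outer (∈-select⁻ _ x∈C) ¬C (inj₂ w∈N[b]) , outside (¬C , ¬R)

  R-outer⁻ : ∀ {y w} → y ∈ R → y ~ w × w ∉ C × w ∉ R → w ∈ Vp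
  R-outer⁻ {w = w} y∈R (y~w , w∉C , w∉R) = ∈-select⁺ _ (¬C , ¬R , ~InR⇒Universal (∈-select⁻ _ y∈R) y~w ¬C ¬R)
    where
    ¬C : ¬ InC w
    ¬C = w∉C ∘ ∈-select⁺ _
    ¬R : ¬ InR w
    ¬R = w∉R ∘ ∈-select⁺ _

  R-outer⁺ : ∀ {y w} → y ∈ R → w ∈ Vp → y ~ w × w ∉ C × w ∉ R
  R-outer⁺ y∈R w∈Vp = let (¬C , ¬R , universal) = ∈-select⁻ _ w∈Vp in
    Universal⇒~InR (∈-select⁻ _ y∈R) ¬R universal , outside (¬C , ¬R)

  isComb : IsComb G C R l Cs Rs
  isComb =
    (λ v v∈C v∈R → InC⇒≢InR (∈-select⁻ _ v∈C) (∈-select⁻ _ v∈R) refl) ,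
    (λ u v u∈C v∈C u≢v → ∈N[]⇒~ (Above⇒∈N[] (proj₁ (∈-select⁻ _ u∈C)) (proj₁ (∈-select⁻ _ v∈C))) (u≢v ∘ sym)) ,
    C⇔⋃Cs , Cs-disjoint , (λ i → Cs-nonempty i , Cs-critical i) ,
    R⇔⋃Rs , Rs-disjoint ,
    (λ i → Rs-nonempty i , Rs-module i , ⊆M⇒TriviallyPerfect (proj₁ ∘ proj₁ ∘ ∈-select⁻ _)) ,
    Rs-non-adjacent , (λ i v → mk⇔ N[Cs]∩R⁻ N[Cs]∩R⁺) , (λ i v → mk⇔ N[Rs]∩C⁻ N[Rs]∩C⁺) ,
    Vf , Vp , (λ w → outside ∘ Vf-outer) , (λ w → outside ∘ Vp-outer) ,
    (λ x x∈C w → mk⇔ (C-outer⁻ x∈C) (C-outer⁺ x∈C)) , (λ y y∈R w → mk⇔ (R-outer⁻ y∈R) (R-outer⁺ y∈R))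

  Outside UniversalPart Bottom : Subset order
  Outside       = select (λ x → (x ∈? M) ×-dec ¬? (Above? x))
  UniversalPart = select (λ x → (x ∈? M) ×-dec Universal? x)
  Bottom        = select (λ x → Above? x ×-dec x ≼? b)

  M-split : ∀ {x} → x ∈ M → x ∈ UniversalPart ∪ Bottom ⊎ x ∈ C ∪ Outside
  M-split {x} x∈M = by-cases (Above? x) (Universal? x) (x ≼? b)
    where
    by-cases : Dec (Above x) → Dec (Universal x) → Dec (x ≼ b) → x ∈ UniversalPart ∪ Bottom ⊎ x ∈ C ∪ Outside
    by-cases (no ¬above) _                _       = inj₂ (x∈p∪q⁺ (inj₂ (∈-select⁺ _ (x∈M , ¬above))))
    by-cases (yes above) (yes universal) _       = inj₁ (x∈p∪q⁺ (inj₁ (∈-select⁺ _ (x∈M , universal))))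
    by-cases (yes above) (no _)          (yes x≼b) = inj₁ (x∈p∪q⁺ (inj₂ (∈-select⁺ _ (above , x≼b))))
    by-cases (yes above) (no ¬universal) (no x⋠b)  = inj₂ (x∈p∪q⁺ (inj₁ (∈-select⁺ _ (above , ¬universal , x⋠b))))

  ∣M∣≤parts : ∣ M ∣ ≤ (∣ UniversalPart ∣ + ∣ Bottom ∣) + (∣ C ∣ + ∣ Outside ∣)
  ∣M∣≤parts = ≤-trans (covered⇒∣p∣≤∣q∣+∣r∣ M-split)
    (+-mono-≤ (∣p∪q∣≤∣p∣+∣q∣ UniversalPart Bottom) (∣p∪q∣≤∣p∣+∣q∣ C Outside))

  representative : Fin l → Vertex
  representative = proj₁ ∘ Rs-nonempty

  representative∈Rs : ∀ i → representative i ∈ Rs i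
  representative∈Rs = proj₂ ∘ Rs-nonempty

  Rs⊆Outside : ∀ {i y} → y ∈ Rs i → y ∈ Outside
  Rs⊆Outside y∈Rs = let ((y∈M , ¬above , _) , _) = ∈-select⁻ _ y∈Rs in ∈-select⁺ _ (y∈M , ¬above)

  l≤∣Outside∣ : l ≤ ∣ Outside ∣
  l≤∣Outside∣ = injection⇒m≤∣p∣ {p = Outside} representative
    (λ i j eq → Rs-disjoint i j _ (representative∈Rs i) (subst (_∈ Rs j) (sym eq) (representative∈Rs j))) (Rs⊆Outside ∘ representative∈Rs)

  module _ {k : ℕ} (cond2 : Cond2 G k) where

    ∣UniversalPart∣≤1+k : ∣ UniversalPart ∣ ≤ suc k
    ∣UniversalPart∣≤1+k = pairwise-≼⇒∣p∣≤1+k cond2 UniversalPart nested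
      where
      nested : ∀ u v → u ∈ UniversalPart → v ∈ UniversalPart → u ≼ v
      nested u v u∈ v∈ w w∈N[u] =
        let (u∈M , _) = ∈-select⁻ _ u∈ ; (v∈M , universal-v) = ∈-select⁻ _ v∈ in
        [ universal-v w , (λ w∉M → inj₂ (~-outside u∈M v∈M w∉M (∈N[]⇒~ w∈N[u] (λ { refl → w∉M u∈M })))) ]′
          (∈⊎∉ (w ∈? M))

    ∣Bottom∣≤1+k : ∣ Bottom ∣ ≤ suc k
    ∣Bottom∣≤1+k = pairwise-≼⇒∣p∣≤1+k cond2 Bottom
      (λ u v u∈ v∈ → ≼-trans (proj₂ (∈-select⁻ _ u∈)) (proj₂ (proj₂ (proj₁ (∈-select⁻ _ v∈)))))

    ∣Cs∣≤1+k : ∀ i → ∣ Cs i ∣ ≤ suc k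
    ∣Cs∣≤1+k i = cond2 (Cs i) (Cs-critical i)

    ∣C∣≤l*[1+k] : ∣ C ∣ ≤ l * suc k
    ∣C∣≤l*[1+k] = ≤-trans (∣T∣≤prefSum Cs l (λ {v} v∈C → let (i , v∈Cs) = Equivalence.to (C⇔⋃Cs v) v∈C in i , toℕ<n i , v∈Cs))
                          (prefSum≤p*K Cs ∣Cs∣≤1+k l)
      where open Packings G

    ∣C∣≤6k+2 : Cond4 G k → ∣ C ∣ ≤ 6 * k + 2
    ∣C∣≤6k+2 cond4 = ≮⇒≥ λ large →
      cond4 C R l Cs Rs isComb (two-sided-packings k Cs C Cs-disjoint Cs-nonempty ∣Cs∣≤1+k C⇔⋃Cs large)
      where open Packings G

    ∣M∣≤11k+2 : Cond4 G k → ∣ Outside ∣ ≤ k + k → ∣ M ∣ ≤ 11 * k + 2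
    ∣M∣≤11k+2 cond4 ∣Outside∣≤2k = begin
      ∣ M ∣                                                    ≤⟨ ∣M∣≤parts ⟩
      (∣ UniversalPart ∣ + ∣ Bottom ∣) + (∣ C ∣ + ∣ Outside ∣) ≤⟨ +-mono-≤ (+-mono-≤ ∣UniversalPart∣≤1+k ∣Bottom∣≤1+k)
                                                                          (+-monoʳ-≤ ∣ C ∣ ∣Outside∣≤2k) ⟩
      (suc k + suc k) + (∣ C ∣ + (k + k))                      ≤⟨ parts≤11k+2 k (∣C∣≤6k+2 cond4) ∣C∣≤2k*[1+k] ⟩
      11 * k + 2                                               ∎
      where
      open ≤-Reasoning
      ∣C∣≤2k*[1+k] : ∣ C ∣ ≤ (k + k) * suc k
      ∣C∣≤2k*[1+k] = ≤-trans ∣C∣≤l*[1+k] (*-monoˡ-≤ (suc k) (≤-trans l≤∣Outside∣ ∣Outside∣≤2k))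

-- Anti-matchings

module AntiMatchings (G : Graph) (M : Subset (Graph.n G)) where

  open Neighbourhoods G

  AntiMatching : ℕ → Set
  AntiMatching s = Σ (Fin s → Vertex) λ a → Σ (Fin s → Vertex) λ b → AntiMatchingIn G M s a b

  InVD? : ∀ {s} (a b : Fin s → Vertex) v → Dec (InVD G a b v)
  InVD? a b v = any? (λ i → (v ≟ᶠ a i) ⊎-dec (v ≟ᶠ b i))

  Maximal : ∀ {s} → (Fin s → Vertex) → (Fin s → Vertex) → Set
  Maximal a b = ∀ u v → u ∈ M → v ∈ M → ¬ InVD G a b u → ¬ InVD G a b v → u ≢ v → u ~ v

  extend : ∀ {s a b u v} → AntiMatchingIn G M s a b → u ∈ M → v ∈ M → u ≢ v → ¬ u ~ v →
    ¬ InVD G a b u → ¬ InVD G a b v → AntiMatchingIn G M (suc s) (u Vector.∷ a) (v Vector.∷ b)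
  extend {s} {a} {b} {u} {v} (in-M , non-edge , a-inj , b-inj , a≢b) u∈M v∈M u≢v u≁v u∉D v∉D =
    in-M′ , non-edge′ , a-inj′ , b-inj′ , a≢b′
    where
    in-M′ : ∀ i → (u Vector.∷ a) i ∈ M × (v Vector.∷ b) i ∈ M
    in-M′ fzero    = u∈M , v∈M
    in-M′ (fsuc i) = in-M i
    non-edge′ : ∀ i → (u Vector.∷ a) i ≢ (v Vector.∷ b) i × ¬ (u Vector.∷ a) i ~ (v Vector.∷ b) i
    non-edge′ fzero    = u≢v , u≁v
    non-edge′ (fsuc i) = non-edge i
    a-inj′ : ∀ i j → (u Vector.∷ a) i ≡ (u Vector.∷ a) j → i ≡ j
    a-inj′ fzero    fzero    _  = refl
    a-inj′ fzero    (fsuc j) eq = contradiction (j , inj₁ eq) u∉D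
    a-inj′ (fsuc i) fzero    eq = contradiction (i , inj₁ (sym eq)) u∉D
    a-inj′ (fsuc i) (fsuc j) eq = cong fsuc (a-inj i j eq)
    b-inj′ : ∀ i j → (v Vector.∷ b) i ≡ (v Vector.∷ b) j → i ≡ j
    b-inj′ fzero    fzero    _  = refl
    b-inj′ fzero    (fsuc j) eq = contradiction (j , inj₂ eq) v∉D
    b-inj′ (fsuc i) fzero    eq = contradiction (i , inj₂ (sym eq)) v∉D
    b-inj′ (fsuc i) (fsuc j) eq = cong fsuc (b-inj i j eq)
    a≢b′ : ∀ i j → (u Vector.∷ a) i ≢ (v Vector.∷ b) j
    a≢b′ fzero    fzero    = u≢v
    a≢b′ fzero    (fsuc j) = u∉D ∘ (j ,_) ∘ inj₂
    a≢b′ (fsuc i) fzero    = v∉D ∘ (i ,_) ∘ inj₁ ∘ sym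
    a≢b′ (fsuc i) (fsuc j) = a≢b i j

  private
    NonEdgeOutside : ∀ {s} → (Fin s → Vertex) → (Fin s → Vertex) → Vertex → Vertex → Set
    NonEdgeOutside a b u v = u ∈ M × v ∈ M × ¬ InVD G a b u × ¬ InVD G a b v × u ≢ v × ¬ u ~ v

    NonEdgeOutside? : ∀ {s} (a b : Fin s → Vertex) u v → Dec (NonEdgeOutside a b u v)
    NonEdgeOutside? a b u v = (u ∈? M) ×-dec ((v ∈? M) ×-dec (¬? (InVD? a b u) ×-dec (¬? (InVD? a b v) ×-dec
                              (¬? (u ≟ᶠ v) ×-dec ¬? (u ~? v)))))

    grow : ∀ k t s (a b : Fin s → Vertex) → s + t ≡ k → AntiMatchingIn G M s a b →
      AntiMatching (suc k) ⊎ (Σ ℕ λ s′ → s′ ≤ k × Σ (Fin s′ → Vertex) λ a → Σ (Fin s′ → Vertex) λ b →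
                                AntiMatchingIn G M s′ a b × Maximal a b)
    grow k t s a b s+t≡k D with any? (λ u → any? (λ v → NonEdgeOutside? a b u v))
    ... | no none = inj₂ (s , subst (s ≤_) s+t≡k (m≤m+n s t) , a , b , D , maximal)
      where
      maximal : Maximal a b
      maximal u v u∈M v∈M u∉D v∉D u≢v = decidable-stable (u ~? v) λ u≁v → none (u , v , u∈M , v∈M , u∉D , v∉D , u≢v , u≁v)
    grow k zero s a b s+0≡k D | yes (u , v , u∈M , v∈M , u∉D , v∉D , u≢v , u≁v) =
      inj₁ (subst (AntiMatching ∘ suc) (trans (sym (+-identityʳ s)) s+0≡k)
                  (u Vector.∷ a , v Vector.∷ b , extend D u∈M v∈M u≢v u≁v u∉D v∉D))
    grow k (suc t) s a b s+1+t≡k D | yes (u , v , u∈M , v∈M , u∉D , v∉D , u≢v , u≁v) =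
      grow k t (suc s) (u Vector.∷ a) (v Vector.∷ b) (trans (sym (+-suc s t)) s+1+t≡k) (extend D u∈M v∈M u≢v u≁v u∉D v∉D)

  large-or-maximal : ∀ k →
    AntiMatching (suc k) ⊎ (Σ ℕ λ s → s ≤ k × Σ (Fin s → Vertex) λ a → Σ (Fin s → Vertex) λ b →
                              AntiMatchingIn G M s a b × Maximal a b)
  large-or-maximal k = grow k k 0 (λ ()) (λ ()) refl ((λ ()) , (λ ()) , (λ ()) , (λ ()) , (λ ()))

  ∣p∣≤2s : ∀ {s} (a b : Fin s → Vertex) {p : Subset (Graph.n G)} → (∀ {v} → v ∈ p → InVD G a b v) → ∣ p ∣ ≤ s + s
  ∣p∣≤2s a b {p} p⊆VD = ≤-trans (covered⇒∣p∣≤∣q∣+∣r∣ split) (+-mono-≤ (∣image∣≤ a) (∣image∣≤ b))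
    where
    split : ∀ {v} → v ∈ p → v ∈ image a ⊎ v ∈ image b
    split v∈p with p⊆VD v∈p
    ... | i , inj₁ refl = inj₁ (∈-image a i)
    ... | i , inj₂ refl = inj₂ (∈-image b i)

2s≤11k+2 : ∀ {s} k → s ≤ suc k → s + s ≤ 11 * k + 2
2s≤11k+2 {s} k s≤1+k = begin
  s + s           ≤⟨ +-mono-≤ s≤1+k s≤1+k ⟩
  suc k + suc k   ≡⟨ solve 1 (λ k → (con 1 :+ k) :+ (con 1 :+ k) := con 2 :* k :+ con 2) refl k ⟩
  2 * k + 2       ≤⟨ +-monoˡ-≤ 2 (*-monoˡ-≤ k (s≤s (s≤s (z≤n {9})))) ⟩
  11 * k + 2      ∎
  where
  open ≤-Reasoning
  open +-*-Solver

module MaximalAntiMatching (G : Graph) (M : Subset (Graph.n G))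
  (M-module : Module G M) (M-tp : TriviallyPerfect G M)
  {s : ℕ} (d₁ d₂ : Fin s → Fin (Graph.n G)) (maximal : AntiMatchings.Maximal G M d₁ d₂) where

  open Neighbourhoods G
  open TriviallyPerfectModule G M M-module M-tp
  open AntiMatchings G M using (InVD?; ∣p∣≤2s)

  Uncovered : Vertex → Set
  Uncovered x = x ∈ M × ¬ InVD G d₁ d₂ x

  Uncovered? : ∀ x → Dec (Uncovered x)
  Uncovered? x = (x ∈? M) ×-dec ¬? (InVD? d₁ d₂ x)

  -- By maximality the uncovered vertices form a clique, so the one of least degree lies below all others.
  lowest-uncovered-below : ∀ {b x} (U-b : Uncovered b) → (∀ y → Uncovered y → deg b ≤ deg y) → Uncovered x →
    CombBelow.Above G M M-module M-tp b (proj₁ U-b) x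
  lowest-uncovered-below {b} {x} (b∈M , b∉D) lowest U-x@(x∈M , x∉D) with x ≟ᶠ b
  ... | yes refl = x∈M , inj₁ refl , ≼-refl
  ... | no x≢b   = x∈M , inj₂ b~x , [ id , (λ x≼b → ≼⇒deg≤⇒≽ x≼b (lowest x U-x)) ]′ (~⇒≼⊎≽ b∈M x∈M b~x)
    where
    b~x : b ~ x
    b~x = maximal b x b∈M x∈M b∉D x∉D (x≢b ∘ sym)

  Outside⊆VD : ∀ {b} (U-b : Uncovered b) → (∀ y → Uncovered y → deg b ≤ deg y) →
    ∀ {x} → x ∈ CombBelow.Outside G M M-module M-tp b (proj₁ U-b) → InVD G d₁ d₂ x
  Outside⊆VD U-b lowest {x} x∈Outside = let (x∈M , ¬above) = ∈-select⁻ _ x∈Outside in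
    decidable-stable (InVD? d₁ d₂ x) (λ x∉D → ¬above (lowest-uncovered-below U-b lowest (x∈M , x∉D)))

  ∣M∣≤11k+2 : ∀ {k} → s ≤ k → Cond2 G k → Cond4 G k → ∣ M ∣ ≤ 11 * k + 2
  ∣M∣≤11k+2 {k} s≤k cond2 cond4 = by-cases (any? Uncovered?)
    where
    by-cases : Dec (∃ Uncovered) → ∣ M ∣ ≤ 11 * k + 2
    by-cases (no none) = ≤-trans
      (∣p∣≤2s d₁ d₂ (λ {v} v∈M → decidable-stable (InVD? d₁ d₂ v) (λ v∉D → none (v , v∈M , v∉D))))
      (2s≤11k+2 k (m≤n⇒m≤1+n s≤k))
    by-cases (yes some) =
      let (b , U-b , lowest) = argmin Uncovered? deg some in
      CombBelow.∣M∣≤11k+2 G M M-module M-tp b (proj₁ U-b) cond2 cond4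
        (≤-trans (∣p∣≤2s d₁ d₂ (Outside⊆VD U-b lowest)) (+-mono-≤ s≤k s≤k))

lemma6 : (G : Graph) (k : ℕ) →
    Cond1 G → Cond2 G k → Cond3 G k → Cond4 G k →
    ∀ M → Module G M → TriviallyPerfect G M → ∣ M ∣ ≤ 11 * k + 2
lemma6 G k _ cond2 cond3 cond4 M M-module M-tp with AntiMatchings.large-or-maximal G M k
... | inj₁ (d₁ , d₂ , D) =
  ≤-trans (AntiMatchings.∣p∣≤2s G M d₁ d₂ (λ {v} → Equivalence.to (cond3 M M-module M-tp d₁ d₂ D v))) (2s≤11k+2 k ≤-refl)
... | inj₂ (s , s≤k , d₁ , d₂ , _ , maximal) =
  MaximalAntiMatching.∣M∣≤11k+2 G M M-module M-tp d₁ d₂ maximal s≤k cond2 cond4
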